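{- Let $G$ be an edge-colored graph on $n$ vertices which is edge-minimal, let $v\in V(G)$ and $s=d^c(v)$, with the colors at $v$ indexed $1,\dots,s$ so that $d_1(v)\geq d_2(v)\geq\cdots\geq d_s(v)$. Then for every $1\leq i\leq s$, $$rt(v,N_i(v))\geq \sum_{x\in N_i(v)}\big(d^c(x)+d^c(v)-n\big)+d_i(v)\sum_{1\leq j\leq s}\big(d_j(v)-1\big)-d_i(v)\big(d_i(v)-1\big)-\sum_{y\in N_!(v)}d_{c(vy)}(y,N_i(v)).$$
   Context: An edge-colored graph is a simple graph $G$ with edge coloring $c$. $d^c(u)$ is the number of distinct colors on edges incident with $u$. For a color $\alpha$, a vertex $u$ and $X\subseteq V(G)$: $N_\alpha(u)=\{w\in N(u):c(uw)=\alpha\}$, $N_\alpha(u,X)=N_\alpha(u)\cap X$, $d_\alpha(u)=|N_\alpha(u)|$, $d_\alpha(u,X)=|N_\alpha(u,X)|$. $N_!(u)$ is the union of those sets $N_\alpha(u)$ with $|N_\alpha(u)|=1$. $G$ is edge-minimal if for every edge $e$ there is an endpoint $w$ of $e$ with $d^c_{G-e}(w)<d^c_G(w)$. A triangle is rainbow if its edges have pairwise distinct colors; $rt(v,x)$ is the number of rainbow triangles containing edge $vx$ and $rt(v,X)=\sum_{x\in X}rt(v,x)$. -}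

module Defs where

open import Data.Bool using (Bool; true; false; _∧_; _∨_; not)
open import Data.Nat using (ℕ; zero; suc; _≡ᵇ_; _<_; _≥_)
import Data.Nat as ℕ
open import Data.Fin using (Fin)
import Data.Fin as F
open import Data.List using (List; []; _∷_; length; map; filterᵇ; deduplicateᵇ; foldr; allFin)
open import Data.Integer using (ℤ; +_; _+_; _-_; _*_)
open import Relation.Nullary.Decidable using (⌊_⌋)
open import Relation.Binary.PropositionalEquality using (_≡_)

-- An edge-colored simple graph on vertex set Fin n.
-- adj : adjacency (symmetric, irreflexive); c : colour of the edge uw
-- (only meaningful when adj u w ≡ true; symmetric on edges).
record EColGraph (n : ℕ) : Set where
  field
    adj       : Fin n → Fin n → Bool
    adj-sym   : ∀ u w → adj u w ≡ adj w u
    adj-irr   : ∀ u → adj u u ≡ false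
    c         : Fin n → Fin n → ℕ
    c-sym     : ∀ u w → adj u w ≡ true → c u w ≡ c w u

Adj : ℕ → Set
Adj n = Fin n → Fin n → Bool

Col : ℕ → Set
Col n = Fin n → Fin n → ℕ

_==_ : ∀ {n} → Fin n → Fin n → Bool
x == y = ⌊ x F.≟ y ⌋

nbrs : ∀ {n} → Adj n → Fin n → List (Fin n)
nbrs {n} a u = filterᵇ (a u) (allFin n)

dcA : ∀ {n} → Adj n → Col n → Fin n → ℕ
dcA a c u = length (deduplicateᵇ _≡ᵇ_ (map (c u) (nbrs a u)))

delEdge : ∀ {n} → Adj n → Fin n → Fin n → Adj n
delEdge a u w x y = a x y ∧ not ((x == u ∧ y == w) ∨ (x == w ∧ y == u))

module _ {n : ℕ} (G : EColGraph n) where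
  open EColGraph G

  dc : Fin n → ℕ
  dc = dcA adj c

  EdgeMinimal : Set
  EdgeMinimal = ∀ u w → adj u w ≡ true →
    (dcA (delEdge adj u w) c u < dc u) ⊎' (dcA (delEdge adj u w) c w < dc w)
    where open import Data.Sum renaming (_⊎_ to _⊎'_)

  inN : ℕ → Fin n → Fin n → Bool
  inN α u w = adj u w ∧ (c u w ≡ᵇ α)

  Nα : ℕ → Fin n → List (Fin n)
  Nα α u = filterᵇ (inN α u) (allFin n)

  dα : ℕ → Fin n → ℕ
  dα α u = length (Nα α u)

  dαX : ℕ → Fin n → (Fin n → Bool) → ℕ
  dαX α u X = length (filterᵇ (λ w → inN α u w ∧ X w) (allFin n))

  Nbang : Fin n → List (Fin n)
  Nbang u = filterᵇ (λ y → adj u y ∧ (dα (c u y) u ≡ᵇ 1)) (allFin n)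

  distinct3 : ℕ → ℕ → ℕ → Bool
  distinct3 a b d = not (a ≡ᵇ b) ∧ not (a ≡ᵇ d) ∧ not (b ≡ᵇ d)

  -- rt(v,x): number of rainbow triangles containing the edge vx (0 if vx is not an edge)
  rt : Fin n → Fin n → ℕ
  rt v x = length (filterᵇ
    (λ w → adj v x ∧ adj v w ∧ adj x w ∧ distinct3 (c v x) (c v w) (c x w))
    (allFin n))

sumℤ : List ℤ → ℤ
sumℤ = foldr _+_ (+ 0)

sumℕ : List ℕ → ℕ
sumℕ = foldr ℕ._+_ 0

module Submission where

-- Fix x ∈ Nᵢ(v), let α be the colour i, and count over all vertices w. Each colour at x other
-- than α shows up on some edge xw with c(xw) ≠ α, and at least Σⱼ dⱼ(v) − dᵢ(v) edges vw have
-- c(vw) ≠ α. If w is joined to both v and x by edges not coloured α, then vxw is a rainbow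
-- triangle unless c(vw) = c(xw); in that case edge-minimality forces vw to be the only edge of its
-- colour at v, so w ∈ N!(v) and w is counted by d_{c(vw)}(w, Nᵢ(v)). Since v and x themselves lie
-- in neither set, inclusion–exclusion over the n vertices gives
--   d^c(x) + Σⱼ dⱼ(v) + 1 ≤ rt(v,x) + #{y ∈ N!(v) : c(yx) = c(vy)} + n + dᵢ(v),
-- and summing over x ∈ Nᵢ(v), with the last term counted from the side of N!(v), is the claim.

open import Defs
import Data.Nat as ℕ
open import Data.Nat using (ℕ; _>_)
open import Data.Fin using (Fin)

module Counting where

  open import Data.Bool using (Bool; true; false; _∧_; not)
  open import Data.Bool.Properties using (¬-not)
  open import Data.Product using (_×_; _,_)
  open import Data.Sum using (_⊎_; inj₁; inj₂)
  open import Data.Fin using (Fin; zero; suc)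
  open import Data.Fin.Properties using () renaming (suc-injective to Fin-suc-injective; 0≢1+n to zero≢suc)
  open import Data.List using (List; []; _∷_; length; map; filterᵇ; allFin)
  open import Data.List.Properties using (map-tabulate)
  open import Data.List.Membership.Propositional using (_∈_)
  open import Data.List.Membership.Propositional.Properties using (∈-allFin)
  open import Data.List.Relation.Unary.Any using (here; there)
  open import Data.Nat using (ℕ; suc; _+_; _*_; _≤_; z≤n; s≤s)
  open import Data.Nat.Properties
    using (+-identityʳ; +-mono-≤; *-zeroʳ; *-distribˡ-+; m≤m+n; m≤n+m; ≤-trans; ≤-reflexive; ≤-antisym)
  open import Data.Nat.Tactic.RingSolver using (solve-∀)
  open import Function using (_∘_; id)
  open import Relation.Binary.PropositionalEquality

  𝟙 : Bool → ℕ
  𝟙 true  = 1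
  𝟙 false = 0

  𝟙-∧ : ∀ a b → 𝟙 (a ∧ b) ≡ 𝟙 a * 𝟙 b
  𝟙-∧ true  b = sym (+-identityʳ (𝟙 b))
  𝟙-∧ false b = refl

  𝟙-split : ∀ a e → 𝟙 (a ∧ not e) + 𝟙 (a ∧ e) ≡ 𝟙 a
  𝟙-split true  true  = refl
  𝟙-split true  false = refl
  𝟙-split false e     = refl

  𝟙-exclusive-≤ : ∀ a b e f r q →
    (e ≡ true → a ≡ false × b ≡ false × f ≡ false) → (f ≡ true → a ≡ false × b ≡ false) →
    (a ≡ true → b ≡ true → r ≡ true ⊎ q ≡ true) →
    𝟙 a + 𝟙 b + (𝟙 e + 𝟙 f) ≤ 𝟙 r + 𝟙 q + 1
  𝟙-exclusive-≤ a b true f r q only-e _ _ with only-e refl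
  ... | refl , refl , refl = m≤n+m 1 (𝟙 r + 𝟙 q)
  𝟙-exclusive-≤ a b false true r q _ only-f _ with only-f refl
  ... | refl , refl = m≤n+m 1 (𝟙 r + 𝟙 q)
  𝟙-exclusive-≤ true true false false r q _ _ both with both refl refl
  𝟙-exclusive-≤ true true false false r     q _ _ _ | inj₁ refl = s≤s (m≤n+m 1 (𝟙 q))
  𝟙-exclusive-≤ true true false false true  q _ _ _ | inj₂ refl = s≤s (s≤s z≤n)
  𝟙-exclusive-≤ true true false false false q _ _ _ | inj₂ refl = s≤s (s≤s z≤n)
  𝟙-exclusive-≤ true  false false false r q _ _ _ = m≤n+m 1 (𝟙 r + 𝟙 q)
  𝟙-exclusive-≤ false true  false false r q _ _ _ = m≤n+m 1 (𝟙 r + 𝟙 q)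
  𝟙-exclusive-≤ false false false false r q _ _ _ = z≤n

  ∑ : {A : Set} → List A → (A → ℕ) → ℕ
  ∑ xs f = sumℕ (map f xs)

  module _ {A : Set} where

    ∑-cong : ∀ xs {f g : A → ℕ} → (∀ x → f x ≡ g x) → ∑ xs f ≡ ∑ xs g
    ∑-cong []       f≗g = refl
    ∑-cong (x ∷ xs) f≗g = cong₂ _+_ (f≗g x) (∑-cong xs f≗g)

    ∑-mono-∈ : ∀ xs {f g : A → ℕ} → (∀ {x} → x ∈ xs → f x ≤ g x) → ∑ xs f ≤ ∑ xs g
    ∑-mono-∈ []       f≤g = z≤n
    ∑-mono-∈ (x ∷ xs) f≤g = +-mono-≤ (f≤g (here refl)) (∑-mono-∈ xs (f≤g ∘ there))

    ∑-mono : ∀ xs {f g : A → ℕ} → (∀ x → f x ≤ g x) → ∑ xs f ≤ ∑ xs g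
    ∑-mono xs f≤g = ∑-mono-∈ xs (λ {x} _ → f≤g x)

    ∑-+ : ∀ xs (f g : A → ℕ) → ∑ xs (λ x → f x + g x) ≡ ∑ xs f + ∑ xs g
    ∑-+ []       f g = refl
    ∑-+ (x ∷ xs) f g = trans (cong (f x + g x +_) (∑-+ xs f g)) (interchange (f x) (g x) (∑ xs f) (∑ xs g))
      where
      interchange : ∀ a b c d → (a + b) + (c + d) ≡ (a + c) + (b + d)
      interchange = solve-∀

    ∑-*ˡ : ∀ xs k (f : A → ℕ) → ∑ xs (λ x → k * f x) ≡ k * ∑ xs f
    ∑-*ˡ []       k f = sym (*-zeroʳ k)
    ∑-*ˡ (x ∷ xs) k f = trans (cong (k * f x +_) (∑-*ˡ xs k f)) (sym (*-distribˡ-+ k (f x) (∑ xs f)))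

    ∑-const : ∀ xs k → ∑ xs (λ (_ : A) → k) ≡ length xs * k
    ∑-const []       k = refl
    ∑-const (x ∷ xs) k = cong (k +_) (∑-const xs k)

    ∈⇒≤∑ : ∀ {xs x} (f : A → ℕ) → x ∈ xs → f x ≤ ∑ xs f
    ∈⇒≤∑ {y ∷ xs} f (here refl) = m≤m+n (f y) (∑ xs f)
    ∈⇒≤∑ {y ∷ xs} f (there x∈xs) = ≤-trans (∈⇒≤∑ f x∈xs) (m≤n+m (∑ xs f) (f y))

    length-filterᵇ : ∀ (p : A → Bool) xs → length (filterᵇ p xs) ≡ ∑ xs (𝟙 ∘ p)
    length-filterᵇ p []       = refl
    length-filterᵇ p (x ∷ xs) with p x
    ... | true  = cong suc (length-filterᵇ p xs)
    ... | false = length-filterᵇ p xs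

    ∑-filterᵇ : ∀ (p : A → Bool) (f : A → ℕ) xs → ∑ (filterᵇ p xs) f ≡ ∑ xs (λ x → 𝟙 (p x) * f x)
    ∑-filterᵇ p f []       = refl
    ∑-filterᵇ p f (x ∷ xs) with p x
    ... | true  = cong₂ _+_ (sym (+-identityʳ (f x))) (∑-filterᵇ p f xs)
    ... | false = ∑-filterᵇ p f xs

    ∑-𝟙-false : ∀ {p : A → Bool} xs → (∀ x → p x ≡ false) → ∑ xs (𝟙 ∘ p) ≡ 0
    ∑-𝟙-false []       p≡false = refl
    ∑-𝟙-false (x ∷ xs) p≡false = cong₂ _+_ (cong 𝟙 (p≡false x)) (∑-𝟙-false xs p≡false)

  ∑-map : ∀ {A B : Set} (g : A → B) (f : B → ℕ) xs → ∑ (map g xs) f ≡ ∑ xs (f ∘ g)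
  ∑-map g f []       = refl
  ∑-map g f (x ∷ xs) = cong (f (g x) +_) (∑-map g f xs)

  ∑-comm : ∀ {A B : Set} xs ys (f : A → B → ℕ) →
           ∑ xs (λ x → ∑ ys (f x)) ≡ ∑ ys (λ y → ∑ xs (λ x → f x y))
  ∑-comm []       ys f = sym (trans (∑-const ys 0) (*-zeroʳ (length ys)))
  ∑-comm (x ∷ xs) ys f =
    trans (cong (∑ ys (f x) +_) (∑-comm xs ys f)) (sym (∑-+ ys (f x) (λ y → ∑ xs (λ x′ → f x′ y))))

  ∑-filterᵇ-comm : ∀ {A B : Set} (p : A → Bool) (q : B → Bool) (r : B → A → Bool) xs ys →
    ∑ (filterᵇ p xs) (λ x → ∑ ys (λ y → 𝟙 (q y ∧ r y x)))
      ≡ ∑ (filterᵇ q ys) (λ y → length (filterᵇ (λ x → r y x ∧ p x) xs))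
  ∑-filterᵇ-comm p q r xs ys = begin
    ∑ (filterᵇ p xs) (λ x → ∑ ys (λ y → 𝟙 (q y ∧ r y x)))
      ≡⟨ ∑-filterᵇ p _ xs ⟩
    ∑ xs (λ x → 𝟙 (p x) * ∑ ys (λ y → 𝟙 (q y ∧ r y x)))
      ≡⟨ ∑-cong xs (λ x → sym (∑-*ˡ ys (𝟙 (p x)) _)) ⟩
    ∑ xs (λ x → ∑ ys (λ y → 𝟙 (p x) * 𝟙 (q y ∧ r y x)))
      ≡⟨ ∑-comm xs ys _ ⟩
    ∑ ys (λ y → ∑ xs (λ x → 𝟙 (p x) * 𝟙 (q y ∧ r y x)))
      ≡⟨ ∑-cong ys (λ y → ∑-cong xs (λ x → rotate (p x) (q y) (r y x))) ⟩
    ∑ ys (λ y → ∑ xs (λ x → 𝟙 (q y) * 𝟙 (r y x ∧ p x)))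
      ≡⟨ ∑-cong ys (λ y → ∑-*ˡ xs (𝟙 (q y)) _) ⟩
    ∑ ys (λ y → 𝟙 (q y) * ∑ xs (λ x → 𝟙 (r y x ∧ p x)))
      ≡⟨ ∑-cong ys (λ y → cong (𝟙 (q y) *_) (sym (length-filterᵇ _ xs))) ⟩
    ∑ ys (λ y → 𝟙 (q y) * length (filterᵇ (λ x → r y x ∧ p x) xs))
      ≡⟨ ∑-filterᵇ q _ ys ⟨
    ∑ (filterᵇ q ys) (λ y → length (filterᵇ (λ x → r y x ∧ p x) xs)) ∎
    where
    open ≡-Reasoning
    rotate : ∀ a b c → 𝟙 a * 𝟙 (b ∧ c) ≡ 𝟙 b * 𝟙 (c ∧ a)
    rotate true  true  true  = refl
    rotate true  true  false = refl
    rotate true  false c     = refl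
    rotate false true  true  = refl
    rotate false true  false = refl
    rotate false false c     = refl

  ∑-allFin-suc : ∀ {m} (f : Fin (suc m) → ℕ) → ∑ (allFin (suc m)) f ≡ f zero + ∑ (allFin m) (f ∘ suc)
  ∑-allFin-suc f =
    cong (λ xs → f zero + sumℕ xs) (trans (map-tabulate suc f) (sym (map-tabulate id (f ∘ suc))))

  ∑-𝟙-≤1 : ∀ {m} (p : Fin m → Bool) → (∀ j k → p j ≡ true → p k ≡ true → j ≡ k) →
    ∑ (allFin m) (𝟙 ∘ p) ≤ 1
  ∑-𝟙-≤1 {ℕ.zero} p at-most-one = z≤n
  ∑-𝟙-≤1 {suc m}  p at-most-one rewrite ∑-allFin-suc (𝟙 ∘ p) with p zero in p₀
  ... | true  = ≤-reflexive (cong suc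
                  (∑-𝟙-false (allFin m) (λ j → ¬-not λ pⱼ → zero≢suc (at-most-one _ _ p₀ pⱼ))))
  ... | false = ∑-𝟙-≤1 (p ∘ suc) (λ j k pⱼ pₖ → Fin-suc-injective (at-most-one (suc j) (suc k) pⱼ pₖ))

  ∑-𝟙-unique : ∀ {m} (p : Fin m → Bool) {w} → p w ≡ true → (∀ u → p u ≡ true → u ≡ w) →
    ∑ (allFin m) (𝟙 ∘ p) ≡ 1
  ∑-𝟙-unique p {w} p-w only-w = ≤-antisym
    (∑-𝟙-≤1 p (λ j k pⱼ pₖ → trans (only-w j pⱼ) (sym (only-w k pₖ))))
    (subst (_≤ ∑ (allFin _) (𝟙 ∘ p)) (cong 𝟙 p-w) (∈⇒≤∑ (𝟙 ∘ p) (∈-allFin w)))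

module Distinct where

  open import Data.Bool using (not; T; T?)
  open import Data.Bool.Properties using (T-not-≡)
  open import Data.List using (List; []; _∷_; length; filter; filterᵇ; deduplicate; deduplicateᵇ; removeAt)
  open import Data.List.Properties using (length-removeAt′; filter-≐)
  open import Data.List.Membership.Propositional using (_∈_)
  open import Data.List.Membership.Propositional.Properties using (∈-deduplicate⁺; ∈-deduplicate⁻; ∈-filter⁺)
  open import Data.List.Relation.Binary.Subset.Propositional using (_⊆_)
  open import Data.List.Relation.Unary.All using () renaming (lookup to All-lookup)
  open import Data.List.Relation.Unary.AllPairs using ([]; _∷_)
  open import Data.List.Relation.Unary.Any using (here; there; index)
  open import Data.List.Relation.Unary.Unique.Propositional using (Unique)
  open import Data.Nat using (ℕ; suc; _≤_; _≡ᵇ_; z≤n; s≤s)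
  open import Data.Nat.Properties using (_≟_; ≡ᵇ⇒≡; ≡⇒≡ᵇ)
  open import Data.List.Relation.Unary.Unique.DecPropositional.Properties _≟_ using (deduplicate-!)
  open import Data.Product using (_,_)
  open import Function using (_∘_)
  open import Function.Bundles using (Equivalence)
  open import Relation.Binary.PropositionalEquality
  open import Relation.Nullary using (¬_; yes; no; contradiction)
  open import Relation.Nullary.Decidable using (¬?; dec-false)
  open import Relation.Unary using (_≐_)

  module _ {A : Set} where

    ∈-removeAt : ∀ {ys : List A} {u z} (u∈ys : u ∈ ys) → z ∈ ys → z ≢ u → z ∈ removeAt ys (index u∈ys)
    ∈-removeAt (here refl) (here refl)  z≢u = contradiction refl z≢u
    ∈-removeAt (here refl) (there z∈ys) z≢u = z∈ys
    ∈-removeAt (there u∈ys) (here refl) z≢u = here refl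
    ∈-removeAt (there u∈ys) (there z∈ys) z≢u = there (∈-removeAt u∈ys z∈ys z≢u)

    Unique-length-≤ : ∀ {us ys : List A} → Unique us → us ⊆ ys → length us ≤ length ys
    Unique-length-≤ [] us⊆ys = z≤n
    Unique-length-≤ {u ∷ us} {ys} (u∉us ∷ !us) us⊆ys =
      subst (suc (length us) ≤_) (sym (length-removeAt′ ys (index u∈ys)))
        (s≤s (Unique-length-≤ !us us⊆ys─u))
      where
      u∈ys : u ∈ ys
      u∈ys = us⊆ys (here refl)
      us⊆ys─u : us ⊆ removeAt ys (index u∈ys)
      us⊆ys─u z∈us = ∈-removeAt u∈ys (us⊆ys (there z∈us)) (λ z≡u → All-lookup u∉us z∈us (sym z≡u))

  #distinct : List ℕ → ℕ
  #distinct xs = length (deduplicateᵇ _≡ᵇ_ xs)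

  deduplicateᵇ-≡ᵇ : ∀ xs → deduplicateᵇ _≡ᵇ_ xs ≡ deduplicate _≟_ xs
  deduplicateᵇ-≡ᵇ []       = refl
  deduplicateᵇ-≡ᵇ (x ∷ xs) = cong (x ∷_) (trans (cong (filter _) (deduplicateᵇ-≡ᵇ xs))
    (filter-≐ (¬? ∘ T? ∘ (x ≡ᵇ_)) (¬? ∘ (x ≟_)) same-test (deduplicate _≟_ xs)))
    where
    same-test : (λ y → ¬ T (x ≡ᵇ y)) ≐ (λ y → x ≢ y)
    same-test = (λ x≢ᵇy x≡y → x≢ᵇy (≡⇒≡ᵇ x _ x≡y)) , (λ x≢y x≡ᵇy → x≢y (≡ᵇ⇒≡ x _ x≡ᵇy))

  #distinct-mono : ∀ {xs ys} → xs ⊆ ys → #distinct xs ≤ #distinct ys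
  #distinct-mono {xs} {ys} xs⊆ys rewrite deduplicateᵇ-≡ᵇ xs | deduplicateᵇ-≡ᵇ ys =
    Unique-length-≤ (deduplicate-! xs) (∈-deduplicate⁺ _≟_ ∘ xs⊆ys ∘ ∈-deduplicate⁻ _≟_ xs)

  #distinct≤1+#≢ : ∀ α xs → #distinct xs ≤ suc (length (filterᵇ (λ z → not (z ≡ᵇ α)) xs))
  #distinct≤1+#≢ α xs rewrite deduplicateᵇ-≡ᵇ xs = Unique-length-≤ (deduplicate-! xs) ⊆α∷≢α
    where
    ⊆α∷≢α : deduplicate _≟_ xs ⊆ α ∷ filterᵇ (λ z → not (z ≡ᵇ α)) xs
    ⊆α∷≢α {z} z∈ with z ≟ α
    ... | yes z≡α = here z≡α
    ... | no  z≢α = there (∈-filter⁺ (T? ∘ λ z → not (z ≡ᵇ α)) (∈-deduplicate⁻ _≟_ xs z∈)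
                                     (Equivalence.from T-not-≡ (dec-false (z ≟ α) z≢α)))


module BooleanTests where

  open import Data.Bool using (true; false; _∧_)
  open import Data.Bool.Properties using (T-≡)
  import Data.Fin as Fin
  open import Data.Nat using (ℕ; _≡ᵇ_)
  open import Data.Nat.Properties using (_≟_; ≡ᵇ⇒≡)
  open import Data.Product using (_×_; _,_)
  open import Function.Bundles using (Equivalence)
  open import Relation.Binary.PropositionalEquality
  open import Relation.Nullary using (¬_; yes; no; contradiction)
  open import Relation.Nullary.Decidable using (isYes≗does; dec-true; dec-false; toWitness)
  open import Data.List using (allFin)
  open Counting using (𝟙; ∑; ∑-𝟙-unique)

  ∧-true : ∀ {a b} → a ≡ true → b ≡ true → (a ∧ b) ≡ true
  ∧-true refl refl = refl

  ∧-true⁻ : ∀ a {b} → (a ∧ b) ≡ true → a ≡ true × b ≡ true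
  ∧-true⁻ true b≡true = refl , b≡true

  ≡ᵇ-true : ∀ {m n} → m ≡ n → (m ≡ᵇ n) ≡ true
  ≡ᵇ-true {m} {n} = dec-true (m ≟ n)

  ≡ᵇ-false : ∀ {m n} → m ≢ n → (m ≡ᵇ n) ≡ false
  ≡ᵇ-false {m} {n} = dec-false (m ≟ n)

  ≡ᵇ-true⁻ : ∀ {m n} → (m ≡ᵇ n) ≡ true → m ≡ n
  ≡ᵇ-true⁻ {m} {n} eq = ≡ᵇ⇒≡ m n (Equivalence.from T-≡ eq)

  ==-true : ∀ {k} {x y : Fin k} → x ≡ y → (x == y) ≡ true
  ==-true {x = x} {y} x≡y = trans (isYes≗does (x Fin.≟ y)) (dec-true (x Fin.≟ y) x≡y)

  ==-false : ∀ {k} {x y : Fin k} → x ≢ y → (x == y) ≡ false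
  ==-false {x = x} {y} x≢y = trans (isYes≗does (x Fin.≟ y)) (dec-false (x Fin.≟ y) x≢y)

  ==-true⁻ : ∀ {k} {x y : Fin k} → (x == y) ≡ true → x ≡ y
  ==-true⁻ eq = toWitness (Equivalence.from T-≡ eq)

  ==∧==-false : ∀ {k} {x y p q : Fin k} → ¬ (x ≡ p × y ≡ q) → (x == p ∧ y == q) ≡ false
  ==∧==-false {_} {x} {y} {p} {q} not-both with x Fin.≟ p | y Fin.≟ q
  ... | yes x≡p | yes y≡q = contradiction (x≡p , y≡q) not-both
  ... | yes _   | no _    = refl
  ... | no _    | _       = refl

  ∑-𝟙-== : ∀ {k} (w : Fin k) → ∑ (allFin k) (λ u → 𝟙 (u == w)) ≡ 1
  ∑-𝟙-== w = ∑-𝟙-unique (_== w) (==-true refl) (λ u → ==-true⁻)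

module ColourDegree {n : ℕ} where

  open import Data.Bool using (true; T?)
  open import Data.Bool.Properties using (T-≡)
  import Data.Fin as Fin
  open import Data.List using (map; allFin)
  open import Data.List.Membership.Propositional using (_∈_)
  open import Data.List.Membership.Propositional.Properties using (∈-map⁺; ∈-map⁻; ∈-filter⁺; ∈-filter⁻; ∈-allFin)
  open import Data.Nat using (_≤_)
  open import Data.Product using (∃; _×_; _,_; proj₂)
  open import Function using (_∘_; case_of_)
  open import Function.Bundles using (Equivalence)
  open import Relation.Binary.PropositionalEquality
  open import Relation.Nullary using (¬_; yes; no)
  open Distinct using (#distinct-mono)
  open BooleanTests using (==∧==-false)

  module _ (a : Adj n) (c : Col n) where

    colour-∈ : ∀ {u w} → a u w ≡ true → c u w ∈ map (c u) (nbrs a u)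
    colour-∈ {u} {w} a-uw = ∈-map⁺ (c u) (∈-filter⁺ (T? ∘ a u) (∈-allFin w) (Equivalence.from T-≡ a-uw))

    colour-∈⁻ : ∀ {u z} → z ∈ map (c u) (nbrs a u) → ∃ λ w → a u w ≡ true × z ≡ c u w
    colour-∈⁻ {u} z∈ with ∈-map⁻ (c u) z∈
    ... | w , w∈ , z≡cuw = w , Equivalence.to T-≡ (proj₂ (∈-filter⁻ (T? ∘ a u) {xs = allFin n} w∈)) , z≡cuw

  dcA-mono : ∀ (a a′ : Adj n) (c : Col n) {u} →
    (∀ {w} → a u w ≡ true → ∃ λ w′ → a′ u w′ ≡ true × c u w′ ≡ c u w) → dcA a c u ≤ dcA a′ c u
  dcA-mono a a′ c {u} colours-kept = #distinct-mono {map (c u) (nbrs a u)} λ z∈ →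
    case colour-∈⁻ a c z∈ of λ where
      (w , a-uw , refl) → case colours-kept a-uw of λ where
        (w′ , a′-uw′ , same) → subst (_∈ map (c u) (nbrs a′ u)) same (colour-∈ a′ c a′-uw′)

  colour-repeated⇒dcA-≤ : ∀ (a a′ : Adj n) (c : Col n) {t t′ r} →
    (∀ {y} → a t y ≡ true → y ≢ t′ → a′ t y ≡ true) → a′ t r ≡ true → c t r ≡ c t t′ →
    dcA a c t ≤ dcA a′ c t
  colour-repeated⇒dcA-≤ a a′ c {t} {t′} {r} kept a′-tr same = dcA-mono a a′ c λ {y} a-ty →
    case y Fin.≟ t′ of λ where
      (yes refl) → r , a′-tr , same
      (no y≢t′)  → y , kept a-ty y≢t′ , refl

  delEdge-keeps : ∀ (a : Adj n) {p q x y} → a x y ≡ true →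
    ¬ (x ≡ p × y ≡ q) → ¬ (x ≡ q × y ≡ p) → delEdge a p q x y ≡ true
  delEdge-keeps a a-xy ≢pq ≢qp rewrite a-xy | ==∧==-false ≢pq | ==∧==-false ≢qp = refl

module ColourClasses {n : ℕ} (G : EColGraph n) (v : Fin n) where

  open EColGraph G
  open import Data.Bool using (Bool; true; false; _∧_; not; T?)
  open import Data.Bool.Properties using (T-≡; ∧-zeroʳ)
  open import Data.Empty using (⊥-elim)
  import Data.Fin as Fin
  open import Data.List using (List; length; map; filterᵇ; allFin)
  open import Data.List.Properties using (length-tabulate)
  open import Data.List.Membership.Propositional using (_∈_)
  open import Data.List.Membership.Propositional.Properties using (∈-filter⁻)
  open import Data.Nat using (suc; _+_; _*_; _≤_; _≡ᵇ_)
  open import Data.Nat.Properties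
    using (_≟_; +-mono-≤; +-monoˡ-≤; ≤-trans; ≤-reflexive; <⇒≱; *-identityʳ; module ≤-Reasoning)
  open import Data.Nat.Tactic.RingSolver using (solve-∀)
  open import Data.Product using (_×_; _,_; proj₁; proj₂)
  open import Data.Sum using (_⊎_; inj₁; inj₂)
  open import Function using (_∘_; id)
  open import Function.Bundles using (Equivalence)
  open import Relation.Binary.PropositionalEquality
  open import Relation.Nullary using (yes; no; contradiction)
  open import Relation.Nullary.Decidable using (decidable-stable)
  open Counting
  open Distinct using (#distinct≤1+#≢)
  open BooleanTests
  open ColourDegree

  adj⇒≢ : ∀ {u w} → adj u w ≡ true → u ≢ w
  adj⇒≢ {u} a-uw refl with trans (sym a-uw) (adj-irr u)
  ... | ()

  dα≡1 : ∀ {w} → adj v w ≡ true → (∀ u → adj v u ≡ true → c v u ≡ c v w → u ≡ w) →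
    dα G (c v w) v ≡ 1
  dα≡1 {w} a-vw only-w = trans (length-filterᵇ (inN G (c v w) v) (allFin n))
    (∑-𝟙-unique (inN G (c v w) v) (∧-true a-vw (≡ᵇ-true {c v w} refl))
      λ u vu∈ → let a-vu , same = ∧-true⁻ (adj v u) vu∈ in only-w u a-vu (≡ᵇ-true⁻ same))

  -- Deleting vw cannot lower d^c(w), since its colour survives at w on wx; so it lowers d^c(v).
  monochromatic-path⇒dα≡1 : EdgeMinimal G → ∀ {w x} → adj v w ≡ true → adj w x ≡ true → x ≢ v →
    c w x ≡ c v w → dα G (c v w) v ≡ 1
  monochromatic-path⇒dα≡1 em {w} {x} a-vw a-wx x≢v same with em v w a-vw
  ... | inj₂ w-loses = ⊥-elim (<⇒≱ w-loses (colour-repeated⇒dcA-≤ adj (delEdge adj v w) c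
          kept-at-w (kept-at-w a-wx x≢v) (trans same (c-sym v w a-vw))))
    where
    w≢v : w ≢ v
    w≢v = adj⇒≢ a-vw ∘ sym
    kept-at-w : ∀ {y} → adj w y ≡ true → y ≢ v → delEdge adj v w w y ≡ true
    kept-at-w a-wy y≢v = delEdge-keeps adj a-wy (λ (w≡v , _) → w≢v w≡v) (λ (_ , y≡v) → y≢v y≡v)
  ... | inj₁ v-loses = dα≡1 a-vw λ u a-vu same′ → decidable-stable (u Fin.≟ w) λ u≢w →
          <⇒≱ v-loses (colour-repeated⇒dcA-≤ adj (delEdge adj v w) c kept-at-v
            (kept-at-v a-vu u≢w) same′)
    where
    kept-at-v : ∀ {y} → adj v y ≡ true → y ≢ w → delEdge adj v w v y ≡ true
    kept-at-v a-vy y≢w =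
      delEdge-keeps adj a-vy (λ (_ , y≡w) → y≢w y≡w) (λ (v≡w , _) → adj⇒≢ a-vw v≡w)

  distinct3-true : ∀ {a b d} → a ≢ b → a ≢ d → b ≢ d → distinct3 G a b d ≡ true
  distinct3-true a≢b a≢d b≢d rewrite ≡ᵇ-false a≢b | ≡ᵇ-false a≢d | ≡ᵇ-false b≢d = refl

  deg : ℕ
  deg = ∑ (allFin n) (𝟙 ∘ adj v)

  ∑dα≤deg : ∀ {s} (col : Fin s → ℕ) → (∀ j k → col j ≡ col k → j ≡ k) →
    ∑ (allFin s) (λ j → dα G (col j) v) ≤ deg
  ∑dα≤deg {s} col col-injective = begin
    ∑ (allFin s) (λ j → dα G (col j) v)
      ≡⟨ ∑-cong (allFin s) (λ j → length-filterᵇ (inN G (col j) v) (allFin n)) ⟩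
    ∑ (allFin s) (λ j → ∑ (allFin n) (𝟙 ∘ inN G (col j) v))
      ≡⟨ ∑-comm (allFin s) (allFin n) _ ⟩
    ∑ (allFin n) (λ w → ∑ (allFin s) (λ j → 𝟙 (adj v w ∧ (c v w ≡ᵇ col j))))
      ≤⟨ ∑-mono (allFin n) (λ w → at-most-one-class (adj v w) (c v w)) ⟩
    deg ∎
    where
    open ≤-Reasoning
    at-most-one-class : ∀ a β → ∑ (allFin s) (λ j → 𝟙 (a ∧ (β ≡ᵇ col j))) ≤ 𝟙 a
    at-most-one-class false β = ≤-reflexive (∑-𝟙-false (allFin s) (λ _ → refl))
    at-most-one-class true  β = ∑-𝟙-≤1 (λ j → β ≡ᵇ col j)
      λ j k β≡colⱼ β≡colₖ → col-injective j k (trans (sym (≡ᵇ-true⁻ {β} β≡colⱼ)) (≡ᵇ-true⁻ {β} β≡colₖ))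

  module _ (α : ℕ) where

    offα : Fin n → Fin n → Bool
    offα u w = adj u w ∧ not (c u w ≡ᵇ α)

    offColour : Fin n → ℕ
    offColour u = ∑ (allFin n) (𝟙 ∘ offα u)

    inN! : Fin n → Bool
    inN! y = adj v y ∧ (dα G (c v y) v ≡ᵇ 1)

    -- #{y ∈ N!(v) : c(yx) = c(vy)}; summed over x ∈ N_α(v) it is the last term of the bound.
    mono!-paths : Fin n → ℕ
    mono!-paths x = ∑ (allFin n) (λ y → 𝟙 (inN! y ∧ inN G (c v y) y x))

    rainbow : Fin n → Fin n → Bool
    rainbow x w = adj v x ∧ adj v w ∧ adj x w ∧ distinct3 G (c v x) (c v w) (c x w)

    offα-self : ∀ u → offα u u ≡ false
    offα-self u = cong (_∧ _) (adj-irr u)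

    offα-α : ∀ {u w} → c u w ≡ α → offα u w ≡ false
    offα-α {u} {w} cuw≡α = trans (cong (λ b → adj u w ∧ not b) (≡ᵇ-true cuw≡α)) (∧-zeroʳ (adj u w))

    offα-true⁻ : ∀ {u w} → offα u w ≡ true → adj u w ≡ true × c u w ≢ α
    offα-true⁻ {u} {w} off =
      proj₁ (∧-true⁻ (adj u w) off) , λ cuw≡α → contradiction (trans (sym off) (offα-α cuw≡α)) λ ()

    offColour-pair-≤-at : EdgeMinimal G → ∀ {x} → adj v x ≡ true → c v x ≡ α → ∀ w →
      𝟙 (offα v w) + 𝟙 (offα x w) + (𝟙 (w == v) + 𝟙 (w == x))
        ≤ 𝟙 (rainbow x w) + 𝟙 (inN! w ∧ inN G (c v w) w x) + 1
    offColour-pair-≤-at em {x} a-vx cvx≡α w = 𝟙-exclusive-≤ _ _ _ _ _ _ at-v at-x both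
      where
      x≢v : x ≢ v
      x≢v = adj⇒≢ a-vx ∘ sym
      at-v : (w == v) ≡ true → offα v w ≡ false × offα x w ≡ false × (w == x) ≡ false
      at-v w=v with ==-true⁻ w=v
      ... | refl = offα-self v , offα-α (trans (sym (c-sym v x a-vx)) cvx≡α) , ==-false (x≢v ∘ sym)
      at-x : (w == x) ≡ true → offα v w ≡ false × offα x w ≡ false
      at-x w=x with ==-true⁻ w=x
      ... | refl = offα-α cvx≡α , offα-self x
      both : offα v w ≡ true → offα x w ≡ true →
             rainbow x w ≡ true ⊎ (inN! w ∧ inN G (c v w) w x) ≡ true
      both off-v off-x with offα-true⁻ off-v | offα-true⁻ off-x
      ... | a-vw , cvw≢α | a-xw , cxw≢α with c v w ≟ c x w
      ... | no cvw≢cxw = inj₁ (∧-true a-vx (∧-true a-vw (∧-true a-xw (distinct3-true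
              (λ e → cvw≢α (trans (sym e) cvx≡α)) (λ e → cxw≢α (trans (sym e) cvx≡α)) cvw≢cxw))))
      ... | yes cvw≡cxw = inj₂ (∧-true
              (∧-true a-vw (≡ᵇ-true (monochromatic-path⇒dα≡1 em a-vw a-wx x≢v cwx≡cvw)))
              (∧-true a-wx (≡ᵇ-true cwx≡cvw)))
        where
        a-wx : adj w x ≡ true
        a-wx = trans (adj-sym w x) a-xw
        cwx≡cvw : c w x ≡ c v w
        cwx≡cvw = trans (sym (c-sym x w a-xw)) (sym cvw≡cxw)

    offColour-pair-≤ : EdgeMinimal G → ∀ {x} → adj v x ≡ true → c v x ≡ α →
      offColour v + offColour x + 2 ≤ rt G v x + mono!-paths x + n
    offColour-pair-≤ em {x} a-vx cvx≡α =
      subst₂ _≤_ lhs rhs (∑-mono (allFin n) (offColour-pair-≤-at em a-vx cvx≡α))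
      where
      lhs : ∑ (allFin n) (λ w → 𝟙 (offα v w) + 𝟙 (offα x w) + (𝟙 (w == v) + 𝟙 (w == x)))
            ≡ offColour v + offColour x + 2
      lhs = trans (∑-+ (allFin n) _ _) (cong₂ _+_ (∑-+ (allFin n) _ _)
              (trans (∑-+ (allFin n) _ _) (cong₂ _+_ (∑-𝟙-== v) (∑-𝟙-== x))))
      rhs : ∑ (allFin n) (λ w → 𝟙 (rainbow x w) + 𝟙 (inN! w ∧ inN G (c v w) w x) + 1)
            ≡ rt G v x + mono!-paths x + n
      rhs = trans (∑-+ (allFin n) _ (λ _ → 1)) (cong₂ _+_
              (trans (∑-+ (allFin n) _ _) (cong (_+ mono!-paths x) (sym (length-filterᵇ (rainbow x) (allFin n)))))
              (trans (∑-const (allFin n) 1) (trans (*-identityʳ _) (length-tabulate id))))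

    dc≤1+offColour : ∀ u → dc G u ≤ suc (offColour u)
    dc≤1+offColour u = subst (λ k → dc G u ≤ suc k) count (#distinct≤1+#≢ α (map (c u) (nbrs adj u)))
      where
      open ≡-Reasoning
      count : length (filterᵇ (λ z → not (z ≡ᵇ α)) (map (c u) (nbrs adj u))) ≡ offColour u
      count = begin
        length (filterᵇ (λ z → not (z ≡ᵇ α)) (map (c u) (nbrs adj u)))
          ≡⟨ length-filterᵇ _ (map (c u) (nbrs adj u)) ⟩
        ∑ (map (c u) (nbrs adj u)) (λ z → 𝟙 (not (z ≡ᵇ α)))
          ≡⟨ ∑-map (c u) _ (nbrs adj u) ⟩
        ∑ (nbrs adj u) (λ w → 𝟙 (not (c u w ≡ᵇ α)))
          ≡⟨ ∑-filterᵇ (adj u) _ (allFin n) ⟩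
        ∑ (allFin n) (λ w → 𝟙 (adj u w) * 𝟙 (not (c u w ≡ᵇ α)))
          ≡⟨ ∑-cong (allFin n) (λ w → sym (𝟙-∧ (adj u w) _)) ⟩
        offColour u ∎

    deg≡offColour+dα : deg ≡ offColour v + dα G α v
    deg≡offColour+dα = begin
      ∑ (allFin n) (𝟙 ∘ adj v)
        ≡⟨ ∑-cong (allFin n) (λ w → sym (𝟙-split (adj v w) (c v w ≡ᵇ α))) ⟩
      ∑ (allFin n) (λ w → 𝟙 (offα v w) + 𝟙 (inN G α v w))
        ≡⟨ ∑-+ (allFin n) _ _ ⟩
      offColour v + ∑ (allFin n) (𝟙 ∘ inN G α v)
        ≡⟨ cong (offColour v +_) (length-filterᵇ (inN G α v) (allFin n)) ⟨
      offColour v + dα G α v ∎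
      where open ≡-Reasoning

    ∈Nα⁻ : ∀ {x} → x ∈ Nα G α v → adj v x ≡ true × c v x ≡ α
    ∈Nα⁻ {x} x∈ with Equivalence.to T-≡ (proj₂ (∈-filter⁻ (T? ∘ inN G α v) {xs = allFin n} x∈))
    ... | vx∈ = let a-vx , cvx≡ᵇα = ∧-true⁻ (adj v x) vx∈ in a-vx , ≡ᵇ-true⁻ cvx≡ᵇα

    per-neighbour : EdgeMinimal G → ∀ {P x} → P ≤ deg → x ∈ Nα G α v →
      dc G x + P + 1 ≤ rt G v x + mono!-paths x + n + dα G α v
    per-neighbour em {P} {x} P≤deg x∈ = begin
      dc G x + P + 1
        ≤⟨ +-monoˡ-≤ 1 (+-mono-≤ (dc≤1+offColour x) (≤-trans P≤deg (≤-reflexive deg≡offColour+dα))) ⟩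
      suc (offColour x) + (offColour v + d) + 1
        ≡⟨ regroup (offColour x) (offColour v) d ⟩
      offColour v + offColour x + 2 + d
        ≤⟨ +-monoˡ-≤ d (offColour-pair-≤ em (proj₁ (∈Nα⁻ x∈)) (proj₂ (∈Nα⁻ x∈))) ⟩
      rt G v x + mono!-paths x + n + d ∎
      where
      open ≤-Reasoning
      d : ℕ
      d = dα G α v
      regroup : ∀ a b e → suc a + (b + e) + 1 ≡ b + a + 2 + e
      regroup = solve-∀

    ∑-mono!-paths :
      ∑ (Nα G α v) mono!-paths ≡ sumℕ (map (λ y → dαX G (c v y) y (inN G α v)) (Nbang G v))
    ∑-mono!-paths = ∑-filterᵇ-comm (inN G α v) inN! (λ y → inN G (c v y) y) (allFin n) (allFin n)

    neighbourhood-bound : EdgeMinimal G → ∀ {P} → P ≤ deg →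
      let L = Nα G α v ; d = dα G α v in
      ∑ L (dc G) + d * P + d
        ≤ ∑ L (rt G v) + sumℕ (map (λ y → dαX G (c v y) y (inN G α v)) (Nbang G v)) + d * n + d * d
    neighbourhood-bound em {P} P≤deg = subst₂ _≤_ lhs rhs (∑-mono-∈ L (per-neighbour em P≤deg))
      where
      L : List (Fin n)
      L = Nα G α v
      d : ℕ
      d = dα G α v
      lhs : ∑ L (λ x → dc G x + P + 1) ≡ ∑ L (dc G) + d * P + d
      lhs = trans (∑-+ L _ (λ _ → 1)) (cong₂ _+_
              (trans (∑-+ L (dc G) (λ _ → P)) (cong (∑ L (dc G) +_) (∑-const L P)))
              (trans (∑-const L 1) (*-identityʳ d)))
      rhs : ∑ L (λ x → rt G v x + mono!-paths x + n + d)
            ≡ ∑ L (rt G v) + sumℕ (map (λ y → dαX G (c v y) y (inN G α v)) (Nbang G v)) + d * n + d * d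
      rhs = trans (∑-+ L _ (λ _ → d)) (cong₂ _+_
              (trans (∑-+ L _ (λ _ → n)) (cong₂ _+_
                (trans (∑-+ L (rt G v) mono!-paths) (cong (∑ L (rt G v) +_) ∑-mono!-paths))
                (∑-const L n)))
              (∑-const L d))

module IntegerForm where

  open import Data.Integer using (ℤ; +_; _+_; _-_; _*_; -_; _≤_; +≤+; 0ℤ)
  open import Data.Integer.Properties
    using (pos-+; pos-*; +-monoˡ-≤; +-identityˡ; i≤j⇒i-j≤0; module ≤-Reasoning)
  open import Data.Integer.Tactic.RingSolver using (solve-∀)
  import Data.Nat as ℕ
  open import Data.List using (List; []; _∷_; length; map)
  open import Relation.Binary.PropositionalEquality
  open Counting using (∑)

  sumℤ-map-+ : ∀ {A : Set} (xs : List A) (f : A → ℕ) (k : ℤ) (g : A → ℤ) →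
    (∀ x → g x ≡ + f x + k) → sumℤ (map g xs) ≡ + ∑ xs f + + length xs * k
  sumℤ-map-+ []       f k g g≗ = refl
  sumℤ-map-+ (x ∷ xs) f k g g≗ = begin
    g x + sumℤ (map g xs)
      ≡⟨ cong₂ _+_ (g≗ x) (sumℤ-map-+ xs f k g g≗) ⟩
    (+ f x + k) + (+ ∑ xs f + + length xs * k)
      ≡⟨ regroup (+ f x) (+ ∑ xs f) (+ length xs) k ⟩
    (+ f x + + ∑ xs f) + (+ 1 + + length xs) * k
      ≡⟨ cong₂ (λ a b → a + b * k) (pos-+ (f x) (∑ xs f)) (pos-+ 1 (length xs)) ⟨
    + ∑ (x ∷ xs) f + + length (x ∷ xs) * k ∎
    where
    open ≡-Reasoning
    regroup : ∀ a b l k → (a + k) + (b + l * k) ≡ (a + b) + (+ 1 + l) * k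
    regroup = solve-∀

  ℕ-bound⇒ℤ-bound : ∀ R D B P d s m →
    D ℕ.+ d ℕ.* P ℕ.+ d ℕ.≤ R ℕ.+ B ℕ.+ d ℕ.* m ℕ.+ d ℕ.* d →
    + D + + d * (+ s - + m) + + d * (+ P + + s * - + 1) - + d * (+ d - + 1) - + B ≤ + R
  ℕ-bound⇒ℤ-bound R D B P d s m h = begin
    + D + + d * (+ s - + m) + + d * (+ P + + s * - + 1) - + d * (+ d - + 1) - + B
      ≡⟨ regroup (+ R) (+ D) (+ B) (+ P) (+ d) (+ s) (+ m) ⟩
    (+ D + + d * + P + + d) - (+ R + + B + + d * + m + + d * + d) + + R
      ≤⟨ +-monoˡ-≤ (+ R) (i≤j⇒i-j≤0 (subst₂ _≤_ lhs-cast rhs-cast (+≤+ h))) ⟩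
    0ℤ + + R
      ≡⟨ +-identityˡ (+ R) ⟩
    + R ∎
    where
    open ≤-Reasoning
    regroup : ∀ R D B P d s m →
      D + d * (s - m) + d * (P + s * - + 1) - d * (d - + 1) - B ≡ (D + d * P + d) - (R + B + d * m + d * d) + R
    regroup = solve-∀
    lhs-cast : + (D ℕ.+ d ℕ.* P ℕ.+ d) ≡ + D + + d * + P + + d
    lhs-cast = trans (pos-+ (D ℕ.+ d ℕ.* P) d)
      (cong (_+ + d) (trans (pos-+ D (d ℕ.* P)) (cong (_+_ (+ D)) (pos-* d P))))
    rhs-cast : + (R ℕ.+ B ℕ.+ d ℕ.* m ℕ.+ d ℕ.* d) ≡ + R + + B + + d * + m + + d * + d
    rhs-cast = trans (pos-+ (R ℕ.+ B ℕ.+ d ℕ.* m) (d ℕ.* d))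
      (cong₂ _+_ (trans (pos-+ (R ℕ.+ B) (d ℕ.* m)) (cong₂ _+_ (pos-+ R B) (pos-* d m))) (pos-* d d))

open import Data.Product using (Σ)
import Data.Fin as F
open import Data.List using (List; map; allFin)
open import Data.List.Properties using (length-tabulate)
open import Data.Integer using (ℤ; +_; _+_; _-_; _*_; _≥_; -_)
open import Data.Integer.Properties using (+-assoc; module ≤-Reasoning)
open import Function using (id)
open import Relation.Binary.PropositionalEquality using (_≡_; refl; trans; cong; cong₂)
open Counting using (∑)
open IntegerForm using (sumℤ-map-+; ℕ-bound⇒ℤ-bound)

-- Only ∑ⱼ dⱼ(v) ≤ deg v is used.
lemma1 : ∀ {n} (G : EColGraph n) → EdgeMinimal G → (v : Fin n) →
    (col : Fin (dc G v) → ℕ) →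
    (∀ j k → col j ≡ col k → j ≡ k) →
    (∀ j → dα G (col j) v > 0) →
    (∀ α → dα G α v > 0 → Σ (Fin (dc G v)) (λ j → col j ≡ α)) →
    (∀ j k → j F.≤ k → dα G (col j) v ℕ.≥ dα G (col k) v) →
    ∀ i →
    + sumℕ (map (rt G v) (Nα G (col i) v))
    ≥ sumℤ (map (λ x → + dc G x + + dc G v - + n) (Nα G (col i) v))
    + + dα G (col i) v * sumℤ (map (λ j → + dα G (col j) v - + 1) (allFin (dc G v)))
    - + dα G (col i) v * (+ dα G (col i) v - + 1)
    - + sumℕ (map (λ y → dαX G (EColGraph.c G v y) y (inN G (col i) v)) (Nbang G v))
lemma1 {n} G em v col col-injective _ _ _ i = begin
  sumℤ (map (λ x → + dc G x + + s - + n) L) + + d * sumℤ (map (λ j → + dα G (col j) v - + 1) (allFin s))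
    - + d * (+ d - + 1) - + B
    ≡⟨ cong₂ (λ a b → a + + d * b - + d * (+ d - + 1) - + B) sum-dc sum-dα ⟩
  + ∑ L (dc G) + + d * (+ s - + n) + + d * (+ P + + s * - + 1) - + d * (+ d - + 1) - + B
    ≤⟨ ℕ-bound⇒ℤ-bound (∑ L (rt G v)) (∑ L (dc G)) B P d s n bound ⟩
  + ∑ L (rt G v) ∎
  where
  open ≤-Reasoning
  open ColourClasses G v using (∑dα≤deg; neighbourhood-bound)
  s : ℕ
  s = dc G v
  α : ℕ
  α = col i
  L : List (Fin n)
  L = Nα G α v
  d : ℕ
  d = dα G α v
  P : ℕ
  P = ∑ (allFin s) (λ j → dα G (col j) v)
  B : ℕ
  B = sumℕ (map (λ y → dαX G (EColGraph.c G v y) y (inN G α v)) (Nbang G v))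
  sum-dc : sumℤ (map (λ x → + dc G x + + s - + n) L) ≡ + ∑ L (dc G) + + d * (+ s - + n)
  sum-dc = sumℤ-map-+ L (dc G) (+ s - + n) _ (λ x → +-assoc (+ dc G x) (+ s) (- + n))
  sum-dα : sumℤ (map (λ j → + dα G (col j) v - + 1) (allFin s)) ≡ + P + + s * - + 1
  sum-dα = trans (sumℤ-map-+ (allFin s) (λ j → dα G (col j) v) (- + 1) _ (λ _ → refl))
                 (cong (λ k → + P + + k * - + 1) (length-tabulate {n = s} id))
  bound : ∑ L (dc G) ℕ.+ d ℕ.* P ℕ.+ d ℕ.≤ ∑ L (rt G v) ℕ.+ B ℕ.+ d ℕ.* n ℕ.+ d ℕ.* d
  bound = neighbourhood-bound α em (∑dα≤deg col col-injective)
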